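{- Let $G$ be an undirected graph with a loop at every vertex, regarded as a symmetric digraph on its vertex set $V$. Then there exists a digraph $D$ on $V$ such that $G = D\cap D^T$ and $\operatorname{box}(G) = d_F(D)$. Moreover, $\operatorname{box}(G)\leq d_F(D)$ for every digraph $D$ on $V$ with $G = D\cap D^T$. Consequently, $$\operatorname{box}(G)=\min\{\, d_F(D) : D \text{ a digraph on } V \text{ with } G = D\cap D^T\,\}.$$
   Context: All graphs and digraphs are finite and may have loops; a digraph is identified with its $(0,1)$ adjacency matrix (diagonal entries record loops), and an undirected graph is identified with the symmetric digraph having the same adjacency matrix. For digraphs on a common vertex set, $D_1\cap D_2$ is the digraph whose arc set is the intersection of the arc sets. $D^T$ is the digraph whose adjacency matrix is the transpose of that of $D$. An interval graph (with a loop at every vertex) is a graph whose vertices can be assigned closed real intervals so that $u,v$ are adjacent (including $u=v$) iff their intervals intersect. The boxicity $\operatorname{box}(G)$ is the minimum number $b$ such that $G$ is the intersection of $b$ interval graphs on $V$ (equivalently, $G$ is the intersection graph of axis-parallel boxes in $\mathbb{R}^b$); the boxicity of a complete graph is taken to be $0$. A Ferrers digraph is a digraph whose successor sets $\{u : vu \text{ is an arc}\}$, $v\in V$, are linearly ordered by inclusion (equivalently, its adjacency matrix contains no $2\times 2$ permutation submatrix). The Ferrers dimension $d_F(D)$ is the minimum number of Ferrers digraphs on $V$ whose intersection is $D$ (with the convention that the intersection of an empty family is the complete digraph with all loops). -}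

module Defs where

open import Data.Nat using (ℕ; _≤_)
open import Data.Fin using (Fin)
open import Data.Bool using (Bool; true; _∧_)
open import Data.Product using (Σ; _×_; ∃-syntax)
open import Data.Sum using (_⊎_)
open import Relation.Binary.PropositionalEquality using (_≡_)

-- A digraph on the vertex set Fin n, identified with its (0,1) adjacency
-- matrix (true = arc; diagonal entries record loops).
Digraph : ℕ → Set
Digraph n = Fin n → Fin n → Bool

Arc : ∀ {n} → Digraph n → Fin n → Fin n → Set
Arc D u v = D u v ≡ true

_∩_ : ∀ {n} → Digraph n → Digraph n → Digraph n
(D ∩ E) u v = D u v ∧ E u v

_ᵀ : ∀ {n} → Digraph n → Digraph n
(D ᵀ) u v = D v u

_≐_ : ∀ {n} → Digraph n → Digraph n → Set
D ≐ E = ∀ u v → D u v ≡ E u v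

IsReflexiveGraph : ∀ {n} → Digraph n → Set
IsReflexiveGraph {n} G = (∀ u v → G u v ≡ G v u) × (∀ v → Arc G v v)

-- D is the intersection of the family F of k digraphs
-- (the empty family has as intersection the complete digraph with all loops).
IsIntersectionOf : ∀ {n k} → Digraph n → (Fin k → Digraph n) → Set
IsIntersectionOf {n} {k} D F =
  ∀ u v → (Arc D u v → ∀ i → Arc (F i) u v) × ((∀ i → Arc (F i) u v) → Arc D u v)

-- Interval graph (with a loop at every vertex): vertices get closed intervals
-- [l v , r v]; u,v adjacent (including u = v) iff the intervals intersect.
-- Endpoints are taken in ℕ.
IsIntervalGraph : ∀ {n} → Digraph n → Set
IsIntervalGraph {n} G =
  Σ (Fin n → ℕ) λ l → Σ (Fin n → ℕ) λ r →
    (∀ v → l v ≤ r v) ×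
    (∀ u v → (Arc G u v → (l u ≤ r v × l v ≤ r u)) ×
             ((l u ≤ r v × l v ≤ r u) → Arc G u v))

SuccSubset : ∀ {n} → Digraph n → Fin n → Fin n → Set
SuccSubset D v w = ∀ u → Arc D v u → Arc D w u

IsFerrers : ∀ {n} → Digraph n → Set
IsFerrers D = ∀ v w → SuccSubset D v w ⊎ SuccSubset D w v

BoxRep : ∀ {n} → Digraph n → ℕ → Set
BoxRep {n} G b = ∃[ F ] ((∀ (i : Fin b) → IsIntervalGraph {n} (F i)) × IsIntersectionOf G F)

IsBoxicity : ∀ {n} → Digraph n → ℕ → Set
IsBoxicity G b = BoxRep G b × (∀ b' → BoxRep G b' → b ≤ b')

FerrersRep : ∀ {n} → Digraph n → ℕ → Set
FerrersRep {n} D d = ∃[ F ] ((∀ (i : Fin d) → IsFerrers {n} (F i)) × IsIntersectionOf D F)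

IsFerrersDim : ∀ {n} → Digraph n → ℕ → Set
IsFerrersDim D d = FerrersRep D d × (∀ d' → FerrersRep D d' → d ≤ d')

{-# OPTIONS --safe #-}
module Submission where

-- Interval graphs are exactly the symmetric parts F ∩ Fᵀ of Ferrers digraphs F
-- with all loops: a Ferrers digraph has a biorder representation
-- (u → v iff b v < a u), and vertex u gets the interval [b u + 1, a u].
-- Hence box(G) ≤ k iff G is the intersection of the symmetric parts of k looped
-- Ferrers digraphs F i, and then D = ⋂ F satisfies G = D ∩ Dᵀ and d_F(D) ≤ k;
-- conversely every Ferrers representation of such a D is one of G.  The least
-- such k exists constructively: the condition is decidable by exhaustive search
-- over Boolean matrices and holds for k = n.

open import Defs
open import Data.Bool using (Bool; true; false; _∧_; not)
open import Data.Bool.Properties using () renaming (_≟_ to _≟ᵇ_)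
open import Data.Fin using (Fin; zero; suc)
open import Data.Fin.Properties using (all?; _≟_)
open import Data.Fin.Subset using (_∈_; _⊆_; ∣_∣)
open import Data.Fin.Subset.Properties using (p⊆q⇒∣p∣≤∣q∣; p⊂q⇒∣p∣<∣q∣)
open import Data.Nat using (ℕ; suc; _≤_; _<_; _≤?_)
open import Data.Nat.Induction using (<-rec)
open import Data.Nat.Properties using (≤-trans; ≤-total; <⇒≱; ≮⇒≥; anyUpTo?)
open import Data.Product using (Σ; _×_; _,_; proj₁; proj₂; ∃; ∃-syntax)
open import Data.Sum using (_⊎_; inj₁; inj₂)
import Data.Sum as Sum
open import Data.Vec using (tabulate)
open import Data.Vec.Properties using (lookup⇒[]=; []=⇒lookup; lookup∘tabulate)
open import Data.Vec.Functional using (_∷_; head; tail)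
open import Data.Vec.Functional.Relation.Binary.Pointwise using (Pointwise)
open import Function using (_∘_)
open import Level using (0ℓ)
open import Relation.Binary using (Rel; Reflexive; _Respects_)
open import Relation.Binary.PropositionalEquality using (_≡_; _≢_; refl; sym; trans; cong; cong₂)
open import Relation.Nullary using (Dec; yes; no; does; contradiction)
open import Relation.Nullary.Decidable using (_×-dec_; _⊎-dec_; _→-dec_; dec-true; map′)
open import Relation.Unary using (Pred; Decidable)

private
  variable
    n k : ℕ

false≢true : false ≢ true
false≢true ()

∧-≡-true⁺ : ∀ {a b} → a ≡ true → b ≡ true → a ∧ b ≡ true
∧-≡-true⁺ refl refl = refl

∧-≡-true⁻ : ∀ a {b} → a ∧ b ≡ true → a ≡ true × b ≡ true
∧-≡-true⁻ true b≡true = refl , b≡true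

≡-true-ext : ∀ {a b} → (a ≡ true → b ≡ true) → (b ≡ true → a ≡ true) → a ≡ b
≡-true-ext {true}  {true}  _ _ = refl
≡-true-ext {true}  {false} f _ = sym (f refl)
≡-true-ext {false} {true}  _ g = g refl
≡-true-ext {false} {false} _ _ = refl

does-true⇒ : ∀ {A : Set} (a? : Dec A) → does a? ≡ true → A
does-true⇒ (yes a) _ = a

#_ : (Fin n → Bool) → ℕ
# p = ∣ tabulate p ∣

∈-tabulate⁺ : ∀ {p : Fin n → Bool} {x} → p x ≡ true → x ∈ tabulate p
∈-tabulate⁺ {p = p} {x} px = lookup⇒[]= x (tabulate p) (trans (lookup∘tabulate p x) px)

∈-tabulate⁻ : ∀ {p : Fin n → Bool} {x} → x ∈ tabulate p → p x ≡ true
∈-tabulate⁻ {p = p} {x} x∈p = trans (sym (lookup∘tabulate p x)) ([]=⇒lookup x∈p)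

tabulate-⊆ : (p q : Fin n → Bool) → (∀ x → p x ≡ true → q x ≡ true) → tabulate p ⊆ tabulate q
tabulate-⊆ p q p⇒q {x} x∈p = ∈-tabulate⁺ {p = q} (p⇒q x (∈-tabulate⁻ {p = p} x∈p))

#-mono : (p q : Fin n → Bool) → (∀ x → p x ≡ true → q x ≡ true) → # p ≤ # q
#-mono p q p⇒q = p⊆q⇒∣p∣≤∣q∣ (tabulate-⊆ p q p⇒q)

#-mono-< : (p q : Fin n → Bool) → (∀ x → p x ≡ true → q x ≡ true) →
           ∀ y → q y ≡ true → p y ≡ false → # p < # q
#-mono-< p q p⇒q y qy py = p⊂q⇒∣p∣<∣q∣
  ( tabulate-⊆ p q p⇒q
  , y , ∈-tabulate⁺ qy , λ y∈p → false≢true (trans (sym py) (∈-tabulate⁻ y∈p)))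

HasLoops : Digraph n → Set
HasLoops D = ∀ v → Arc D v v

symPart : Digraph n → Digraph n
symPart D = D ∩ (D ᵀ)

≐-refl : {D : Digraph n} → D ≐ D
≐-refl _ _ = refl

≐-sym : {D E : Digraph n} → D ≐ E → E ≐ D
≐-sym D≐E u v = sym (D≐E u v)

≐-arc : {D E : Digraph n} → D ≐ E → ∀ {u v} → Arc D u v → Arc E u v
≐-arc D≐E {u} {v} uv = trans (sym (D≐E u v)) uv

symPart-arc⁺ : (D : Digraph n) → ∀ {u v} → Arc D u v → Arc D v u → Arc (symPart D) u v
symPart-arc⁺ D = ∧-≡-true⁺

symPart-arc⁻ : (D : Digraph n) → ∀ {u v} → Arc (symPart D) u v → Arc D u v × Arc D v u
symPart-arc⁻ D {u} {v} = ∧-≡-true⁻ (D u v)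

symPart-cong : {D E : Digraph n} → D ≐ E → symPart D ≐ symPart E
symPart-cong D≐E u v = cong₂ _∧_ (D≐E u v) (D≐E v u)

IsFerrers-resp : {D E : Digraph n} → D ≐ E → IsFerrers D → IsFerrers E
IsFerrers-resp {D = D} {E} D≐E ferrers v w = Sum.map (transport v w) (transport w v) (ferrers v w)
  where
  transport : ∀ v w → SuccSubset D v w → SuccSubset E v w
  transport v w v⊆w u vu = ≐-arc D≐E (v⊆w u (≐-arc (≐-sym D≐E) vu))

HasLoops-resp : {D E : Digraph n} → D ≐ E → HasLoops D → HasLoops E
HasLoops-resp D≐E loops v = ≐-arc D≐E (loops v)

IsIntersectionOf-unique : {G H : Digraph n} {F : Fin k → Digraph n} →
  IsIntersectionOf G F → IsIntersectionOf H F → G ≐ H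
IsIntersectionOf-unique G≡⋂F H≡⋂F u v =
  ≡-true-ext (proj₂ (H≡⋂F u v) ∘ proj₁ (G≡⋂F u v)) (proj₂ (G≡⋂F u v) ∘ proj₁ (H≡⋂F u v))

IsIntersectionOf-resp : {G G′ : Digraph n} {F F′ : Fin k → Digraph n} →
  G ≐ G′ → (∀ i → F i ≐ F′ i) → IsIntersectionOf G F → IsIntersectionOf G′ F′
IsIntersectionOf-resp G≐G′ F≐F′ G≡⋂F u v =
  (λ uv i → ≐-arc (F≐F′ i) (proj₁ (G≡⋂F u v) (≐-arc (≐-sym G≐G′) uv) i)) ,
  (λ all → ≐-arc G≐G′ (proj₂ (G≡⋂F u v) (λ i → ≐-arc (≐-sym (F≐F′ i)) (all i))))

symPart-IsIntersectionOf : {D : Digraph n} {F : Fin k → Digraph n} →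
  IsIntersectionOf D F → IsIntersectionOf (symPart D) (symPart ∘ F)
symPart-IsIntersectionOf {D = D} {F} D≡⋂F u v = to , from
  where
  to : Arc (symPart D) u v → ∀ i → Arc (symPart (F i)) u v
  to uvu i with symPart-arc⁻ D uvu
  ... | uv , vu = symPart-arc⁺ (F i) (proj₁ (D≡⋂F u v) uv i) (proj₁ (D≡⋂F v u) vu i)
  from : (∀ i → Arc (symPart (F i)) u v) → Arc (symPart D) u v
  from all = symPart-arc⁺ D (proj₂ (D≡⋂F u v) (λ i → proj₁ (symPart-arc⁻ (F i) (all i))))
                            (proj₂ (D≡⋂F v u) (λ i → proj₂ (symPart-arc⁻ (F i) (all i))))

⋂ : (Fin k → Digraph n) → Digraph n
⋂ F u v = does (all? λ i → F i u v ≟ᵇ true)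

⋂-IsIntersectionOf : (F : Fin k → Digraph n) → IsIntersectionOf (⋂ F) F
⋂-IsIntersectionOf F u v = does-true⇒ (all? _) , dec-true (all? _)

SuccSubset? : (D : Digraph n) → ∀ v w → Dec (SuccSubset D v w)
SuccSubset? D v w = all? λ u → (D v u ≟ᵇ true) →-dec (D w u ≟ᵇ true)

-- a u counts the successor sets contained in that of u, b v the vertices not
-- pointing to v; nestedness makes the two counted sets comparable.
IsFerrers⇒biorder : {F : Digraph n} → IsFerrers F →
  Σ (Fin n → ℕ) λ a → Σ (Fin n → ℕ) λ b →
    ∀ u v → (Arc F u v → b v < a u) × (b v < a u → Arc F u v)
IsFerrers⇒biorder {F = F} ferrers = a , b , λ u v → arc⇒< , <⇒arc
  where
  below : Fin _ → Fin _ → Bool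
  below u w = does (SuccSubset? F w u)
  missing : Fin _ → Fin _ → Bool
  missing v w = not (F w v)
  a b : Fin _ → ℕ
  a u = # below u
  b v = # missing v

  arc⇒< : ∀ {u v} → Arc F u v → b v < a u
  arc⇒< {u} {v} uv =
    #-mono-< (missing v) (below u) missing⇒below u (dec-true (SuccSubset? F u u) (λ _ p → p)) (cong not uv)
    where
    missing⇒below : ∀ w → not (F w v) ≡ true → does (SuccSubset? F w u) ≡ true
    missing⇒below w ¬wv with F w v in wv | ferrers w u
    ... | false | inj₁ w⊆u = dec-true (SuccSubset? F w u) w⊆u
    ... | false | inj₂ u⊆w = contradiction (trans (sym wv) (u⊆w v uv)) false≢true

  <⇒arc : ∀ {u v} → b v < a u → Arc F u v
  <⇒arc {u} {v} b<a with F u v in uv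
  ... | true  = refl
  ... | false = contradiction (#-mono (below u) (missing v) below⇒missing) (<⇒≱ b<a)
    where
    below⇒missing : ∀ w → does (SuccSubset? F w u) ≡ true → not (F w v) ≡ true
    below⇒missing w w⊆u with F w v in wv
    ... | false = refl
    ... | true  = contradiction (trans (sym uv) (does-true⇒ (SuccSubset? F w u) w⊆u v wv)) false≢true

symPart-IsIntervalGraph : {F : Digraph n} → IsFerrers F → HasLoops F → IsIntervalGraph (symPart F)
symPart-IsIntervalGraph {F = F} ferrers loops with IsFerrers⇒biorder ferrers
... | a , b , arc⇔< = suc ∘ b , a , (λ v → proj₁ (arc⇔< v v) (loops v)) , λ u v → to , from
  where
  to : ∀ {u v} → Arc (symPart F) u v → b u < a v × b v < a u
  to {u} {v} uvu with symPart-arc⁻ F uvu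
  ... | uv , vu = proj₁ (arc⇔< v u) vu , proj₁ (arc⇔< u v) uv
  from : ∀ {u v} → b u < a v × b v < a u → Arc (symPart F) u v
  from {u} {v} (bu<av , bv<au) = symPart-arc⁺ F (proj₂ (arc⇔< u v) bv<au) (proj₂ (arc⇔< v u) bu<av)

IsIntervalGraph⇒symPart : {I : Digraph n} → IsIntervalGraph I →
  Σ (Digraph n) λ F → (IsFerrers F × HasLoops F) × I ≐ symPart F
IsIntervalGraph⇒symPart {I = I} (l , r , l≤r , arc⇔meet) = F , (ferrers , loops) , I≐F∩Fᵀ
  where
  F : Digraph _
  F u v = does (l u ≤? r v)
  ferrers : IsFerrers F
  ferrers v w with ≤-total (l v) (l w)
  ... | inj₁ lv≤lw = inj₂ λ u wu → dec-true (l v ≤? r u) (≤-trans lv≤lw (does-true⇒ (l w ≤? r u) wu))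
  ... | inj₂ lw≤lv = inj₁ λ u vu → dec-true (l w ≤? r u) (≤-trans lw≤lv (does-true⇒ (l v ≤? r u) vu))
  loops : HasLoops F
  loops v = dec-true (l v ≤? r v) (l≤r v)
  I≐F∩Fᵀ : I ≐ symPart F
  I≐F∩Fᵀ u v = ≡-true-ext
    (λ uv → let (lu≤rv , lv≤ru) = proj₁ (arc⇔meet u v) uv
            in symPart-arc⁺ F (dec-true (l u ≤? r v) lu≤rv) (dec-true (l v ≤? r u) lv≤ru))
    (λ uvu → let (uv , vu) = symPart-arc⁻ F uvu
             in proj₂ (arc⇔meet u v) (does-true⇒ (l u ≤? r v) uv , does-true⇒ (l v ≤? r u) vu))

SymFerrersRep : Digraph n → ℕ → Set
SymFerrersRep {n} G k =
  ∃[ F ] ((∀ (i : Fin k) → IsFerrers {n} (F i) × HasLoops (F i)) × IsIntersectionOf G (symPart ∘ F))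

SymFerrersRep⇒BoxRep : {G : Digraph n} → SymFerrersRep G k → BoxRep G k
SymFerrersRep⇒BoxRep (F , ferrers-loops , G≡⋂) =
  symPart ∘ F , (λ i → symPart-IsIntervalGraph (proj₁ (ferrers-loops i)) (proj₂ (ferrers-loops i))) , G≡⋂

BoxRep⇒SymFerrersRep : {G : Digraph n} → BoxRep G k → SymFerrersRep G k
BoxRep⇒SymFerrersRep (I , intervals , G≡⋂I) =
  proj₁ ∘ ferrers , proj₁ ∘ proj₂ ∘ ferrers , IsIntersectionOf-resp ≐-refl (proj₂ ∘ proj₂ ∘ ferrers) G≡⋂I
  where
  ferrers : ∀ i → Σ (Digraph _) λ F → (IsFerrers F × HasLoops F) × I i ≐ symPart F
  ferrers i = IsIntervalGraph⇒symPart (intervals i)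

SymFerrersRep⇒FerrersRep : {G : Digraph n} → SymFerrersRep G k →
  Σ (Digraph n) λ D → G ≐ symPart D × FerrersRep D k
SymFerrersRep⇒FerrersRep (F , ferrers-loops , G≡⋂) =
  ⋂ F ,
  IsIntersectionOf-unique G≡⋂ (symPart-IsIntersectionOf (⋂-IsIntersectionOf F)) ,
  F , proj₁ ∘ ferrers-loops , ⋂-IsIntersectionOf F

FerrersRep⇒SymFerrersRep : {G D : Digraph n} → HasLoops G → G ≐ symPart D →
  FerrersRep D k → SymFerrersRep G k
FerrersRep⇒SymFerrersRep {D = D} loops G≐D∩Dᵀ (F , ferrers , D≡⋂F) =
  F , (λ i → ferrers i , λ v → proj₁ (D≡⋂F v v) (D-loop v) i) ,
  IsIntersectionOf-resp (≐-sym G≐D∩Dᵀ) (λ _ → ≐-refl) (symPart-IsIntersectionOf D≡⋂F)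
  where
  D-loop : HasLoops D
  D-loop v = proj₁ (symPart-arc⁻ D (≐-arc G≐D∩Dᵀ (loops v)))

-- symPart (star G x) is the complete graph minus the non-edges at x; these n
-- interval graphs intersect to G.
star : Digraph n → Fin n → Digraph n
star G x u v with u ≟ x
... | yes _ = G x v
... | no  _ = true

module _ {G : Digraph n} where

  star-centre : ∀ x v → star G x x v ≡ G x v
  star-centre x v with x ≟ x
  ... | yes _   = refl
  ... | no  x≢x = contradiction refl x≢x

  star-arc : ∀ x u v → (u ≡ x → Arc G x v) → Arc (star G x) u v
  star-arc x u v u≡x⇒xv with u ≟ x
  ... | yes u≡x = u≡x⇒xv u≡x
  ... | no  _   = refl

  star-IsFerrers : ∀ x → IsFerrers (star G x)
  star-IsFerrers x v w = by-cases (w ≟ x) (v ≟ x)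
    where
    by-cases : Dec (w ≡ x) → Dec (v ≡ x) → SuccSubset (star G x) v w ⊎ SuccSubset (star G x) w v
    by-cases (no  w≢x)  _          = inj₁ λ u _ → star-arc x w u λ w≡x → contradiction w≡x w≢x
    by-cases (yes _)    (no  v≢x)  = inj₂ λ u _ → star-arc x v u λ v≡x → contradiction v≡x v≢x
    by-cases (yes refl) (yes refl) = inj₁ λ _ vu → vu

  star-HasLoops : HasLoops G → ∀ x → HasLoops (star G x)
  star-HasLoops loops x v = star-arc x v v λ { refl → loops v }

  star-⊇ : ∀ x u v → Arc G u v → Arc (star G x) u v
  star-⊇ x u v uv = star-arc x u v λ { refl → uv }

  SymFerrersRep-stars : IsReflexiveGraph G → SymFerrersRep G n
  SymFerrersRep-stars (symmetric , loops) =
    star G , (λ x → star-IsFerrers x , star-HasLoops loops x) , λ u v → to u v , from u v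
    where
    to : ∀ u v → Arc G u v → ∀ x → Arc (symPart (star G x)) u v
    to u v uv x = symPart-arc⁺ (star G x) {u} {v} (star-⊇ x u v uv) (star-⊇ x v u (trans (symmetric v u) uv))
    from : ∀ u v → (∀ x → Arc (symPart (star G x)) u v) → Arc G u v
    from u v all = trans (sym (star-centre u v)) (proj₁ (symPart-arc⁻ (star G u) {u} {v} (all u)))

Exhaustible : (A : Set) → Rel A 0ℓ → Set₁
Exhaustible A _≈_ = {P : Pred A 0ℓ} → P Respects _≈_ → Decidable P → Dec (∃ P)

Bool-exhaustible : Exhaustible Bool _≡_
Bool-exhaustible _ P? =
  map′ (Sum.[ (true ,_) , (false ,_) ]) (λ { (true , p) → inj₁ p ; (false , p) → inj₂ p })
       (P? true ⊎-dec P? false)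

Π-exhaustible : {A : Set} {_≈_ : Rel A 0ℓ} → Reflexive _≈_ → Exhaustible A _≈_ →
  ∀ k → Exhaustible (Fin k → A) (Pointwise _≈_)
Π-exhaustible _ _ 0 resp P? = map′ (λ p → _ , p) (λ (f , p) → resp (λ ()) p) (P? λ ())
Π-exhaustible {A = A} {_≈_} ≈-refl search (suc k) {P} resp P? =
  map′ (λ (a , f , p) → a ∷ f , p) (λ (f , p) → head f , tail f , resp (λ { zero → ≈-refl ; (suc _) → ≈-refl }) p)
       (search extends-resp extends?)
  where
  Extends : Pred A 0ℓ
  Extends a = ∃ λ f → P (a ∷ f)
  extends-resp : Extends Respects _≈_
  extends-resp a≈b (f , p) = f , resp (λ { zero → a≈b ; (suc _) → ≈-refl }) p
  extends? : Decidable Extends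
  extends? a = Π-exhaustible ≈-refl search k (λ f≈g → resp (λ { zero → ≈-refl ; (suc i) → f≈g i })) (P? ∘ (a ∷_))

Digraph-families-exhaustible : ∀ k n → Exhaustible (Fin k → Digraph n) (Pointwise _≐_)
Digraph-families-exhaustible k n =
  Π-exhaustible (λ _ _ → refl) (Π-exhaustible (λ _ → refl) (Π-exhaustible refl Bool-exhaustible n) n) k

Arc? : (D : Digraph n) → ∀ u v → Dec (Arc D u v)
Arc? D u v = D u v ≟ᵇ true

IsFerrers? : (D : Digraph n) → Dec (IsFerrers D)
IsFerrers? D = all? λ v → all? λ w → SuccSubset? D v w ⊎-dec SuccSubset? D w v

HasLoops? : (D : Digraph n) → Dec (HasLoops D)
HasLoops? D = all? λ v → Arc? D v v

IsIntersectionOf? : (D : Digraph n) (F : Fin k → Digraph n) → Dec (IsIntersectionOf D F)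
IsIntersectionOf? D F = all? λ u → all? λ v →
  (Arc? D u v →-dec all? λ i → Arc? (F i) u v) ×-dec ((all? λ i → Arc? (F i) u v) →-dec Arc? D u v)

SymFerrersRep? : (G : Digraph n) → Decidable (SymFerrersRep G)
SymFerrersRep? {n} G k = Digraph-families-exhaustible k n resp
  (λ F → all? (λ i → IsFerrers? (F i) ×-dec HasLoops? (F i)) ×-dec IsIntersectionOf? G (symPart ∘ F))
  where
  resp : (λ F → (∀ i → IsFerrers (F i) × HasLoops (F i)) × IsIntersectionOf G (symPart ∘ F)) Respects Pointwise _≐_
  resp F≐F′ (ferrers-loops , G≡⋂) =
    (λ i → IsFerrers-resp (F≐F′ i) (proj₁ (ferrers-loops i)) , HasLoops-resp (F≐F′ i) (proj₂ (ferrers-loops i))) ,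
    IsIntersectionOf-resp ≐-refl (symPart-cong ∘ F≐F′) G≡⋂

Least : Pred ℕ 0ℓ → Pred ℕ 0ℓ
Least P m = P m × (∀ m′ → P m′ → m ≤ m′)

least-witness : {P : Pred ℕ 0ℓ} → Decidable P → ∀ {N} → P N → ∃ (Least P)
least-witness {P} P? {N} = <-rec (λ N → P N → ∃ (Least P)) step N
  where
  step : ∀ N → (∀ {M} → M < N → P M → ∃ (Least P)) → P N → ∃ (Least P)
  step N below pN with anyUpTo? P? N
  ... | yes (M , M<N , pM) = below M<N pM
  ... | no  none           = N , pN , λ m′ pm′ → ≮⇒≥ λ m′<N → none (m′ , m′<N , pm′)

boxicity≤FerrersDim : {G D : Digraph n} → HasLoops G → G ≐ symPart D →
  ∀ b d → IsBoxicity G b → IsFerrersDim D d → b ≤ d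
boxicity≤FerrersDim loops G≐D∩Dᵀ b d (_ , box-least) (D-rep , _) =
  box-least d (SymFerrersRep⇒BoxRep (FerrersRep⇒SymFerrersRep loops G≐D∩Dᵀ D-rep))

theorem1 : (n : ℕ) (G : Digraph n) → IsReflexiveGraph G →
    (Σ (Digraph n) λ D → Σ ℕ λ b →
       (G ≐ (D ∩ (D ᵀ))) × IsBoxicity G b × IsFerrersDim D b)
    × ((D : Digraph n) → G ≐ (D ∩ (D ᵀ)) →
       (b d : ℕ) → IsBoxicity G b → IsFerrersDim D d → b ≤ d)
theorem1 n G reflexive@(_ , loops)
  with least-witness (SymFerrersRep? G) (SymFerrersRep-stars reflexive)
... | b , rep , minimal with SymFerrersRep⇒FerrersRep rep
... | D , G≐D∩Dᵀ , D-rep =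
  ( D , b , G≐D∩Dᵀ
  , (SymFerrersRep⇒BoxRep rep , λ b′ → minimal b′ ∘ BoxRep⇒SymFerrersRep)
  , (D-rep , λ d′ → minimal d′ ∘ FerrersRep⇒SymFerrersRep loops G≐D∩Dᵀ))
  , λ _ → boxicity≤FerrersDim loops
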